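{- Let $k\in\mathbb{Z}$ and $n,m\in\mathbb{Z}^+$ with $m\ge3$. Then \[\chi_{n,k}(C_m)=\begin{cases}2 & \text{if } \gcd(3,n)\mid k \text{ and } 2\mid m,\\ 3 & \text{if } \gcd(3,n)\mid k \text{ and } 2\nmid m,\ \text{or if } \gcd(3,n)\nmid k \text{ and } 3\mid m,\end{cases}\] and $\chi_{n,k}(C_m)$ does not exist if $\gcd(3,n)\nmid k$ and $3\nmid m$.
   Context: $C_m$ is the cycle on $m$ vertices. For a graph $G=(V,E)$, a labeling $\ell:V\to\mathbb{Z}$ is proper if adjacent vertices get distinct labels, its order is the size of its image, and it is a closed coloring with remainder $k\bmod n$ if $\sum_{w\in N[v]}\ell(w)\equiv k\pmod n$ for every $v$, where $N[v]$ is the closed neighborhood of $v$. $\chi_{n,k}(G)$ exists iff a proper closed coloring with remainder $k\bmod n$ exists, and then is the minimum order of such a coloring. -}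

module Defs where

open import Data.Nat as ℕ using (ℕ; zero; suc; _%_; _≡ᵇ_)
open import Data.Integer as ℤ using (ℤ; _+_; _-_; +_)
open import Data.Integer.Divisibility using (_∣_)
open import Data.Fin using (Fin; toℕ)
open import Data.Fin as Fin using ()
open import Data.Bool using (Bool; true; false; _∨_; if_then_else_)
open import Data.List using (List; map; length; deduplicate)
open import Data.List using () renaming (allFin to allFinL)
open import Data.Product using (Σ; _×_; ∃)
open import Relation.Nullary using (¬_)
open import Relation.Binary.PropositionalEquality using (_≡_; _≢_)

record Graph : Set where
  field
    N   : ℕ
    adj : Fin N → Fin N → Bool
open Graph public

sumFin : (N : ℕ) → (Fin N → ℤ) → ℤ
sumFin zero    f = + 0
sumFin (suc N) f = f Fin.zero + sumFin N (λ i → f (Fin.suc i))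

Labeling : Graph → Set
Labeling G = Fin (N G) → ℤ

closedSum : (G : Graph) → Labeling G → Fin (N G) → ℤ
closedSum G ℓ v = ℓ v + sumFin (N G) (λ w → if adj G v w then ℓ w else + 0)

_≡_[mod_] : ℤ → ℤ → ℕ → Set
a ≡ b [mod n ] = (+ n) ∣ (a - b)

Proper : (G : Graph) → Labeling G → Set
Proper G ℓ = ∀ v w → adj G v w ≡ true → ℓ v ≢ ℓ w

ClosedColoring : (n : ℕ) (k : ℤ) (G : Graph) → Labeling G → Set
ClosedColoring n k G ℓ = ∀ v → closedSum G ℓ v ≡ k [mod n ]

order : (G : Graph) → Labeling G → ℕ
order G ℓ = length (deduplicate ℤ._≟_ (map ℓ (allFinL (N G))))

ProperClosed : (n : ℕ) (k : ℤ) (G : Graph) → Labeling G → Set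
ProperClosed n k G ℓ = Proper G ℓ × ClosedColoring n k G ℓ

χExists : (n : ℕ) (k : ℤ) (G : Graph) → Set
χExists n k G = ∃ λ ℓ → ProperClosed n k G ℓ

χ≡ : (n : ℕ) (k : ℤ) (G : Graph) (c : ℕ) → Set
χ≡ n k G c = (∃ λ ℓ → ProperClosed n k G ℓ × order G ℓ ≡ c)
           × (∀ ℓ → ProperClosed n k G ℓ → c ℕ.≤ order G ℓ)

Cycle : (m : ℕ) → Graph
Cycle zero    = record { N = zero ; adj = λ () }
Cycle (suc p) = record { N = suc p ; adj = λ i j →
  (toℕ j ≡ᵇ (suc (toℕ i) % suc p)) ∨ (toℕ i ≡ᵇ (suc (toℕ j) % suc p)) }

module Submission where

-- On C_m the closed sum at vertex i is ℓ(i-1) + ℓ(i) + ℓ(i+1), and subtracting consecutive closed sums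
-- gives ℓ(i+3) ≡ ℓ(i) (mod n). If 3 ∤ m this makes all labels congruent modulo n, so 3ℓ(0) ≡ k (mod n),
-- which is solvable exactly when gcd(3,n) ∣ k. The same congruence rules out a labeling alternating
-- between two values when gcd(3,n) ∤ k, while properness alone needs two labels, and three on odd cycles.
-- Conversely, if 3b ≡ k (mod n), the labels b + n·c(v), for a proper colouring c of C_m with two or
-- three colours, form a closed labeling; if gcd(3,n) ∤ k and 3 ∣ m, the labels 0, n, k - n repeated
-- around the cycle have closed sum exactly k and are distinct.

open import Defs
open import Data.Nat using (ℕ; _≤_)
open import Data.Nat.Divisibility using (_∣_)
open import Data.Nat.GCD using (gcd)
open import Data.Integer using (ℤ; +_)
open import Data.Integer.Divisibility using () renaming (_∣_ to _∣ℤ_)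
open import Data.Product using (_×_)
open import Relation.Nullary using (¬_)

import Algebra.Properties.CommutativeMonoid.Sum as MonoidSum
open import Data.Bool using (Bool; true; false; _∨_; if_then_else_; T)
open import Data.Bool.Properties using (T-≡; T-∨)
open import Data.Empty using (⊥-elim)
open import Data.Fin as Fin using (Fin; toℕ)
import Data.Fin.Properties as Fin
open import Data.Integer as ℤ using (_+_; _-_; _*_; -_)
import Data.Integer.Divisibility.Signed as Signed
import Data.Integer.Properties as ℤ
open import Data.Integer.Tactic.RingSolver using (solve-∀)
open import Data.List as List using (List; []; _∷_; length; upTo; deduplicate)
open import Data.List.Membership.Propositional using (_∈_)
open import Data.List.Membership.Propositional.Properties
  using (∈-map⁺; ∈-map⁻; ∈-allFin; ∈-deduplicate⁺; ∈-deduplicate⁻; ∈-filter⁺; ∈-upTo⁺)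
import Data.List.Properties as List
open import Data.List.Relation.Binary.Subset.Propositional using (_⊆_)
import Data.List.Relation.Unary.All as All
open import Data.List.Relation.Unary.All using ([]; _∷_)
open import Data.List.Relation.Unary.AllPairs using ([]; _∷_)
import Data.List.Relation.Unary.Any as Any
open import Data.List.Relation.Unary.Any using (here; there)
open import Data.List.Relation.Unary.Unique.Propositional using (Unique)
open import Data.List.Relation.Unary.Unique.DecPropositional.Properties using (deduplicate-!)
open import Data.Nat as ℕ using (zero; suc; _%_; _/_; _<_; s≤s; z≤n)
open import Data.Nat.DivMod
import Data.Nat.Divisibility as ℕ
open import Data.Nat.GCD using (gcd[m,n]∣m; gcd[m,n]∣n; gcd-greatest)
import Data.Nat.Properties as ℕ
import Data.Nat.Tactic.RingSolver as ℕ-Solver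
open import Data.Product using (_,_; ∃-syntax)
open import Data.Sum using (_⊎_; inj₁; inj₂)
open import Function using (_∘_; mk⇔; Equivalence)
open import Level using (0ℓ)
open import Relation.Binary.Bundles using (Setoid)
open import Relation.Binary.PropositionalEquality
import Relation.Binary.Reasoning.Setoid as SetoidReasoning
open import Relation.Binary.Structures using (IsEquivalence)
open import Relation.Nullary using (yes; no; Dec; ¬?)
open import Relation.Nullary.Decidable using (_⊎-dec_; does-⇔)
open import Relation.Nullary.Negation using (contradiction)

infix 4 _≈_[mod_]

-- The endpoints of `_≡_[mod_]` sit under an absolute value, where unification cannot recover
-- them; as a record, this equivalent relation keeps them inferable.
record _≈_[mod_] (a b : ℤ) (n : ℕ) : Set where
  constructor ≈-mod
  field divides : (+ n) Signed.∣ (a - b)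

module _ {n : ℕ} where

  ≈⇒≡-mod : ∀ {a b} → a ≈ b [mod n ] → a ≡ b [mod n ]
  ≈⇒≡-mod (≈-mod n∣a-b) = Signed.∣⇒∣ᵤ n∣a-b

  ≡-mod⇒≈ : ∀ {a b} → a ≡ b [mod n ] → a ≈ b [mod n ]
  ≡-mod⇒≈ n∣a-b = ≈-mod (Signed.∣ᵤ⇒∣ n∣a-b)

  ≈-mod-via : ∀ {a b x} → (+ n) Signed.∣ x → x ≡ a - b → a ≈ b [mod n ]
  ≈-mod-via n∣x refl = ≈-mod n∣x

  ≈-reflexive : ∀ {a b} → a ≡ b → a ≈ b [mod n ]
  ≈-reflexive {a} refl = ≈-mod-via (Signed.∣ᵤ⇒∣ (n ℕ.∣0)) (sym (ℤ.+-inverseʳ a))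

  ≈-sym : ∀ {a b} → a ≈ b [mod n ] → b ≈ a [mod n ]
  ≈-sym {a} {b} (≈-mod n∣a-b) = ≈-mod-via (Signed.∣m⇒∣-m n∣a-b) (negate a b)
    where negate : ∀ a b → - (a - b) ≡ b - a
          negate = solve-∀

  ≈-trans : ∀ {a b c} → a ≈ b [mod n ] → b ≈ c [mod n ] → a ≈ c [mod n ]
  ≈-trans {a} {b} {c} (≈-mod n∣a-b) (≈-mod n∣b-c) =
    ≈-mod-via (Signed.∣m∣n⇒∣m+n n∣a-b n∣b-c) (telescope a b c)
    where telescope : ∀ a b c → (a - b) + (b - c) ≡ a - c
          telescope = solve-∀

  +-cong-≈ : ∀ {a b c d} → a ≈ b [mod n ] → c ≈ d [mod n ] → a + c ≈ b + d [mod n ]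
  +-cong-≈ {a} {b} {c} {d} (≈-mod n∣a-b) (≈-mod n∣c-d) =
    ≈-mod-via (Signed.∣m∣n⇒∣m+n n∣a-b n∣c-d) (interchange a b c d)
    where interchange : ∀ a b c d → (a - b) + (c - d) ≡ (a + c) - (b + d)
          interchange = solve-∀

  +-multiple-≈ : ∀ a c → a + + n * c ≈ a [mod n ]
  +-multiple-≈ a c = ≈-mod-via (Signed.∣n⇒∣m*n c Signed.∣-refl) (cancel a c (+ n))
    where cancel : ∀ a c n → c * n ≡ (a + n * c) - a
          cancel = solve-∀

  ≈-isEquivalence : IsEquivalence (_≈_[mod n ])
  ≈-isEquivalence = record { refl = ≈-reflexive refl ; sym = ≈-sym ; trans = ≈-trans }

≈-setoid : ℕ → Setoid 0ℓ 0ℓ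
≈-setoid n = record { isEquivalence = ≈-isEquivalence {n} }

gcd[3,n]∣n : ∀ {n} → (+ gcd 3 n) Signed.∣ (+ n)
gcd[3,n]∣n {n} = Signed.∣ᵤ⇒∣ (gcd[m,n]∣n 3 n)

gcd[3,n]∣k-n⇒gcd[3,n]∣k : ∀ n k → (+ gcd 3 n) Signed.∣ (k - + n) → (+ gcd 3 n) ∣ℤ k
gcd[3,n]∣k-n⇒gcd[3,n]∣k n k g∣k-n =
  Signed.∣⇒∣ᵤ (subst (+ gcd 3 n Signed.∣_) (restore k (+ n)) (Signed.∣m∣n⇒∣m+n g∣k-n gcd[3,n]∣n))
  where restore : ∀ k n → (k - n) + n ≡ k
        restore = solve-∀

3*b≈k⇒gcd[3,n]∣k : ∀ {n b k} → + 3 * b ≈ k [mod n ] → (+ gcd 3 n) ∣ℤ k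
3*b≈k⇒gcd[3,n]∣k {n} {b} {k} (≈-mod n∣3b-k) = Signed.∣⇒∣ᵤ
  (subst (+ gcd 3 n Signed.∣_) (cancel (+ 3 * b) k)
    (Signed.∣m∣n⇒∣m-n g∣3b (Signed.∣-trans gcd[3,n]∣n n∣3b-k)))
  where
    g∣3b : (+ gcd 3 n) Signed.∣ (+ 3 * b)
    g∣3b = Signed.∣m⇒∣m*n {m = + 3} b (Signed.∣ᵤ⇒∣ (gcd[m,n]∣m 3 n))
    cancel : ∀ x k → x - (x - k) ≡ k
    cancel = solve-∀

-- In the cases 3 ∤ n, the witness is k times an inverse of 3 modulo n.
gcd[3,n]∣k⇒∃3*b≈k : ∀ n k → (+ gcd 3 n) ∣ℤ k → ∃[ b ] + 3 * b ≈ k [mod n ]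
gcd[3,n]∣k⇒∃3*b≈k n k g∣k with n % 3 | m≡m%n+[m/n]*n n 3 | m%n<n n 3
... | 0 | n≡3q | _ = quotient 3∣k , ≈-reflexive (sym (trans (equality 3∣k) (ℤ.*-comm (quotient 3∣k) (+ 3))))
  where
    gcd≡3 : gcd 3 n ≡ 3
    gcd≡3 = ℕ.∣-antisym (gcd[m,n]∣m 3 n) (gcd-greatest ℕ.∣-refl (ℕ.divides (n / 3) n≡3q))
    3∣k : + 3 Signed.∣ k
    3∣k = Signed.∣ᵤ⇒∣ (subst (λ g → (+ g) ∣ℤ k) gcd≡3 g∣k)
    open Signed._∣_
... | 1 | n≡1+3q | _ = - (+ (n / 3) * k) ,
  ≈-mod-via (Signed.∣n⇒∣m*n (- k) Signed.∣-refl) (trans (cong (- k *_) n≡) (inverse (+ (n / 3)) k))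
  where
    n≡ : + n ≡ + 1 + + (n / 3) * + 3
    n≡ = trans (cong +_ n≡1+3q) (trans (ℤ.pos-+ 1 _) (cong (_+_ (+ 1)) (ℤ.pos-* (n / 3) 3)))
    inverse : ∀ q k → (- k) * (+ 1 + q * + 3) ≡ + 3 * (- (q * k)) - k
    inverse = solve-∀
... | 2 | n≡2+3q | _ = (+ (n / 3) + + 1) * k ,
  ≈-mod-via (Signed.∣n⇒∣m*n k Signed.∣-refl) (trans (cong (k *_) n≡) (inverse (+ (n / 3)) k))
  where
    n≡ : + n ≡ + 2 + + (n / 3) * + 3
    n≡ = trans (cong +_ n≡2+3q) (trans (ℤ.pos-+ 2 _) (cong (_+_ (+ 2)) (ℤ.pos-* (n / 3) 3)))
    inverse : ∀ q k → k * (+ 2 + q * + 3) ≡ + 3 * ((q + + 1) * k) - k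
    inverse = solve-∀
... | suc (suc (suc _)) | _ | s≤s (s≤s (s≤s ()))

[m+n%d]%d≡[m+n]%d : ∀ m n d .{{_ : ℕ.NonZero d}} → (m ℕ.+ n % d) % d ≡ (m ℕ.+ n) % d
[m+n%d]%d≡[m+n]%d m n d = begin
  (m ℕ.+ n % d) % d            ≡⟨ %-distribˡ-+ m (n % d) d ⟩
  (m % d ℕ.+ n % d % d) % d    ≡⟨ cong (λ x → (m % d ℕ.+ x) % d) (m%n%n≡m%n n d) ⟩
  (m % d ℕ.+ n % d) % d        ≡⟨ %-distribˡ-+ m n d ⟨
  (m ℕ.+ n) % d                ∎
  where open ≡-Reasoning

[m%d+n]%d≡[m+n]%d : ∀ m n d .{{_ : ℕ.NonZero d}} → (m % d ℕ.+ n) % d ≡ (m ℕ.+ n) % d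
[m%d+n]%d≡[m+n]%d m n d = begin
  (m % d ℕ.+ n) % d  ≡⟨ cong (_% d) (ℕ.+-comm (m % d) n) ⟩
  (n ℕ.+ m % d) % d  ≡⟨ [m+n%d]%d≡[m+n]%d n m d ⟩
  (n ℕ.+ m) % d      ≡⟨ cong (_% d) (ℕ.+-comm n m) ⟩
  (m ℕ.+ n) % d      ∎
  where open ≡-Reasoning

[1+m]%d≡[1+n]%d⇒m%d≡n%d : ∀ m n d .{{_ : ℕ.NonZero d}} → suc m % d ≡ suc n % d → m % d ≡ n % d
[1+m]%d≡[1+n]%d⇒m%d≡n%d m n d@(suc d-1) eq = begin
  m % d                          ≡⟨ [m+n]%n≡m%n m d ⟨
  (m ℕ.+ d) % d                  ≡⟨ cong (_% d) (ℕ.+-suc m d-1) ⟩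
  (suc m ℕ.+ d-1) % d            ≡⟨ [m%d+n]%d≡[m+n]%d (suc m) d-1 d ⟨
  (suc m % d ℕ.+ d-1) % d        ≡⟨ cong (λ x → (x ℕ.+ d-1) % d) eq ⟩
  (suc n % d ℕ.+ d-1) % d        ≡⟨ [m%d+n]%d≡[m+n]%d (suc n) d-1 d ⟩
  (suc n ℕ.+ d-1) % d            ≡⟨ cong (_% d) (ℕ.+-suc n d-1) ⟨
  (n ℕ.+ d) % d                  ≡⟨ [m+n]%n≡m%n n d ⟩
  n % d                          ∎
  where open ≡-Reasoning

[k+m]%d≡[k+n]%d⇒m%d≡n%d : ∀ k m n d .{{_ : ℕ.NonZero d}} → (k ℕ.+ m) % d ≡ (k ℕ.+ n) % d → m % d ≡ n % d
[k+m]%d≡[k+n]%d⇒m%d≡n%d zero    m n d eq = eq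
[k+m]%d≡[k+n]%d⇒m%d≡n%d (suc k) m n d eq =
  [k+m]%d≡[k+n]%d⇒m%d≡n%d k m n d ([1+m]%d≡[1+n]%d⇒m%d≡n%d (k ℕ.+ m) (k ℕ.+ n) d eq)

[s+m]%d≢m%d : ∀ {s d} m .{{_ : ℕ.NonZero d}} → 0 < s → s < d → (s ℕ.+ m) % d ≢ m % d
[s+m]%d≢m%d {s} {d@(suc _)} m 0<s s<d eq = ℕ.<⇒≢ 0<s (begin
  0 % d        ≡⟨ [k+m]%d≡[k+n]%d⇒m%d≡n%d m 0 s d shifted ⟩
  s % d        ≡⟨ m<n⇒m%n≡m s<d ⟩
  s            ∎)
  where
    open ≡-Reasoning
    shifted : (m ℕ.+ 0) % d ≡ (m ℕ.+ s) % d
    shifted = trans (cong (_% d) (ℕ.+-identityʳ m)) (trans (sym eq) (cong (_% d) (ℕ.+-comm s m)))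

open MonoidSum ℤ.+-0-commutativeMonoid using (sum; sum-cong-≗; ∑-distrib-+; sum-replicate-zero)

sumFin≡sum : ∀ N (f : Fin N → ℤ) → sumFin N f ≡ sum f
sumFin≡sum zero    f = refl
sumFin≡sum (suc N) f = cong (_+_ (f Fin.zero)) (sumFin≡sum N (f ∘ Fin.suc))

restrict : ∀ {N} → (Fin N → Bool) → (Fin N → ℤ) → Fin N → ℤ
restrict p f w = if p w then f w else + 0

at : ∀ {N} → Fin N → Fin N → Bool
at a w = toℕ w ℕ.≡ᵇ toℕ a

sum-restrict-at : ∀ {N} (f : Fin N → ℤ) (a : Fin N) → sum (restrict (at a) f) ≡ f a
sum-restrict-at {suc N} f Fin.zero    = trans (cong (_+_ (f Fin.zero)) (sum-replicate-zero N)) (ℤ.+-identityʳ _)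
sum-restrict-at {suc N} f (Fin.suc a) = trans (ℤ.+-identityˡ _) (sum-restrict-at (f ∘ Fin.suc) a)

if-∨-split : ∀ x y (z : ℤ) → ¬ (T x × T y) →
  (if x ∨ y then z else + 0) ≡ (if x then z else + 0) + (if y then z else + 0)
if-∨-split false false z _    = refl
if-∨-split false true  z _    = sym (ℤ.+-identityˡ z)
if-∨-split true  false z _    = sym (ℤ.+-identityʳ z)
if-∨-split true  true  z both = ⊥-elim (both (_ , _))

sum-restrict-at₂ : ∀ {N} (f : Fin N → ℤ) {a b : Fin N} → a ≢ b →
  sum (restrict (λ w → at a w ∨ at b w) f) ≡ f a + f b
sum-restrict-at₂ f {a} {b} a≢b = begin
  sum (restrict (λ w → at a w ∨ at b w) f)
    ≡⟨ sum-cong-≗ (λ w → if-∨-split _ _ (f w) (disjoint w)) ⟩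
  sum (λ w → restrict (at a) f w + restrict (at b) f w)
    ≡⟨ ∑-distrib-+ (restrict (at a) f) (restrict (at b) f) ⟩
  sum (restrict (at a) f) + sum (restrict (at b) f)
    ≡⟨ cong₂ _+_ (sum-restrict-at f a) (sum-restrict-at f b) ⟩
  f a + f b
    ∎
  where
    open ≡-Reasoning
    disjoint : ∀ w → ¬ (T (at a w) × T (at b w))
    disjoint w (w≡a , w≡b) = a≢b (Fin.toℕ-injective
      (trans (sym (ℕ.≡ᵇ⇒≡ (toℕ w) (toℕ a) w≡a)) (ℕ.≡ᵇ⇒≡ (toℕ w) (toℕ b) w≡b)))

unique-⊆⇒length≤ : ∀ {xs ys : List ℤ} → Unique xs → xs ⊆ ys → length xs ≤ length ys
unique-⊆⇒length≤ {[]}     _          _  = z≤n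
unique-⊆⇒length≤ {x ∷ xs} {ys} (x∉xs ∷ !xs) xs⊆ys = ℕ.≤-trans
  (s≤s (unique-⊆⇒length≤ !xs xs⊆ys-x))
  (List.filter-notAll (λ y → ¬? (y ℤ.≟ x)) ys (Any.map (λ y≡x x≢y → x≢y (sym y≡x)) (xs⊆ys (here refl))))
  where
    xs⊆ys-x : xs ⊆ List.filter (λ y → ¬? (y ℤ.≟ x)) ys
    xs⊆ys-x z∈xs =
      ∈-filter⁺ (λ y → ¬? (y ℤ.≟ x)) (xs⊆ys (there z∈xs)) (λ z≡x → All.lookup x∉xs z∈xs (sym z≡x))

module _ (G : Graph) (ℓ : Labeling G) where

  private
    image : List ℤ
    image = deduplicate ℤ._≟_ (List.map ℓ (List.allFin (N G)))

  order≤ : ∀ {ys} → (∀ v → ℓ v ∈ ys) → order G ℓ ≤ length ys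
  order≤ ℓ∈ys = unique-⊆⇒length≤ (deduplicate-! ℤ._≟_ _) image⊆ys
    where
      image⊆ys : image ⊆ _
      image⊆ys z∈image with ∈-map⁻ ℓ (∈-deduplicate⁻ ℤ._≟_ _ z∈image)
      ... | v , _ , refl = ℓ∈ys v

  ≤order : (vs : List (Fin (N G))) → Unique (List.map ℓ vs) → length vs ≤ order G ℓ
  ≤order vs unique = subst (_≤ order G ℓ) (List.length-map ℓ vs) (unique-⊆⇒length≤ unique ℓvs⊆image)
    where
      ℓvs⊆image : List.map ℓ vs ⊆ image
      ℓvs⊆image z∈ℓvs with ∈-map⁻ ℓ z∈ℓvs
      ... | v , _ , refl = ∈-deduplicate⁺ ℤ._≟_ (∈-map⁺ ℓ (∈-allFin v))

  2≤order : ∀ {a b} → ℓ a ≢ ℓ b → 2 ≤ order G ℓ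
  2≤order {a} {b} a≢b = ≤order (a ∷ b ∷ []) ((a≢b ∷ []) ∷ [] ∷ [])

  3≤order : ∀ {a b c} → ℓ a ≢ ℓ b → ℓ a ≢ ℓ c → ℓ b ≢ ℓ c → 3 ≤ order G ℓ
  3≤order {a} {b} {c} a≢b a≢c b≢c =
    ≤order (a ∷ b ∷ c ∷ []) ((a≢b ∷ a≢c ∷ []) ∷ (b≢c ∷ []) ∷ [] ∷ [])

order-∘≤ : ∀ (G : Graph) (g : ℕ → ℤ) (c : Fin (N G) → ℕ) {d} → (∀ v → c v < d) → order G (g ∘ c) ≤ d
order-∘≤ G g c {d} c<d =
  subst (order G (g ∘ c) ≤_) length-colours (order≤ G (g ∘ c) (λ v → ∈-map⁺ g (∈-upTo⁺ (c<d v))))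
  where
    length-colours : length (List.map g (upTo d)) ≡ d
    length-colours = trans (List.length-map g (upTo d)) (List.length-upTo d)

b+n*-injective : ∀ b n .{{_ : ℕ.NonZero n}} {x y} → b + + n * + x ≡ b + + n * + y → x ≡ y
b+n*-injective b n {x} {y} eq = ℤ.+-injective (ℤ.*-cancelˡ-≡ (+ n) (+ x) (+ y) (begin
  + n * + x              ≡⟨ cancel b (+ n * + x) ⟨
  - b + (b + + n * + x)  ≡⟨ cong (_+_ (- b)) eq ⟩
  - b + (b + + n * + y)  ≡⟨ cancel b (+ n * + y) ⟩
  + n * + y              ∎))
  where
    open ≡-Reasoning
    cancel : ∀ b z → - b + (b + z) ≡ z
    cancel = solve-∀

alternating⇒2-periodic : ∀ {A : Set} (f : ℕ → A) → (∀ i → f i ≢ f (suc i)) →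
  (∀ i → f i ≡ f 0 ⊎ f i ≡ f 1) → ∀ q i → f (q ℕ.* 2 ℕ.+ i) ≡ f i
alternating⇒2-periodic f step twoValued zero    i = refl
alternating⇒2-periodic f step twoValued (suc q) i =
  trans (two-step (q ℕ.* 2 ℕ.+ i)) (alternating⇒2-periodic f step twoValued q i)
  where
    two-step : ∀ j → f (suc (suc j)) ≡ f j
    two-step j with twoValued j | twoValued (suc (suc j)) | twoValued (suc j)
    ... | inj₁ p | inj₁ q | _      = trans q (sym p)
    ... | inj₂ p | inj₂ q | _      = trans q (sym p)
    ... | inj₁ p | inj₂ q | inj₁ r = ⊥-elim (step j (trans p (sym r)))
    ... | inj₁ p | inj₂ q | inj₂ r = ⊥-elim (step (suc j) (trans r (sym q)))
    ... | inj₂ p | inj₁ q | inj₁ r = ⊥-elim (step (suc j) (trans r (sym q)))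
    ... | inj₂ p | inj₁ q | inj₂ r = ⊥-elim (step j (trans p (sym r)))

¬2∣m⇒m≡1+[m/2]*2 : ∀ m → ¬ 2 ∣ m → m ≡ 1 ℕ.+ (m / 2) ℕ.* 2
¬2∣m⇒m≡1+[m/2]*2 m 2∤m with m % 2 | m≡m%n+[m/n]*n m 2 | m%n<n m 2
... | 0           | m≡2q   | _               = contradiction (ℕ.divides (m / 2) m≡2q) 2∤m
... | 1           | m≡1+2q | _               = m≡1+2q
... | suc (suc _) | _      | s≤s (s≤s ())

module _ (n : ℕ) (k : ℤ) where

  threeLabel : ℕ → ℤ
  threeLabel 0 = + 0
  threeLabel 1 = + n
  threeLabel _ = k - + n

  threeLabel-sum : ∀ x → x < 3 → threeLabel (suc x % 3) + (threeLabel (suc (suc x) % 3) + threeLabel x) ≡ k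
  threeLabel-sum 0 _ = sum₀ (+ n) k
    where sum₀ : ∀ n k → n + ((k - n) + + 0) ≡ k
          sum₀ = solve-∀
  threeLabel-sum 1 _ = sum₁ (+ n) k
    where sum₁ : ∀ n k → (k - n) + (+ 0 + n) ≡ k
          sum₁ = solve-∀
  threeLabel-sum 2 _ = sum₂ (+ n) k
    where sum₂ : ∀ n k → + 0 + (n + (k - n)) ≡ k
          sum₂ = solve-∀
  threeLabel-sum (suc (suc (suc _))) (s≤s (s≤s (s≤s ())))

  threeLabel-distinct : .{{ℕ.NonZero n}} → ¬ (+ gcd 3 n) ∣ℤ k →
    ∀ x → x < 3 → threeLabel x ≢ threeLabel (suc x % 3)
  threeLabel-distinct gcd∤k 0 _ 0≡n = ℕ.≢-nonZero⁻¹ n (sym (ℤ.+-injective 0≡n))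
  threeLabel-distinct gcd∤k 1 _ n≡k-n =
    gcd∤k (gcd[3,n]∣k-n⇒gcd[3,n]∣k n k (subst (+ gcd 3 n Signed.∣_) n≡k-n gcd[3,n]∣n))
  threeLabel-distinct gcd∤k 2 _ k-n≡0 =
    gcd∤k (gcd[3,n]∣k-n⇒gcd[3,n]∣k n k (subst (+ gcd 3 n Signed.∣_) (sym k-n≡0) (Signed.∣ᵤ⇒∣ (gcd 3 n ℕ.∣0))))
  threeLabel-distinct gcd∤k (suc (suc (suc _))) (s≤s (s≤s (s≤s ())))

module CycleOf (r : ℕ) where

  M : ℕ
  M = suc (suc (suc r))

  vertex : ℕ → Fin M
  vertex i = Fin.fromℕ< (m%n<n i M)

  toℕ-vertex : ∀ i → toℕ (vertex i) ≡ i % M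
  toℕ-vertex i = Fin.toℕ-fromℕ< (m%n<n i M)

  vertex-≡ : ∀ {v} i → toℕ v ≡ i % M → v ≡ vertex i
  vertex-≡ i v≡i = Fin.toℕ-injective (trans v≡i (sym (toℕ-vertex i)))

  vertex-toℕ : ∀ v → v ≡ vertex (toℕ v)
  vertex-toℕ v = vertex-≡ (toℕ v) (sym (m<n⇒m%n≡m (Fin.toℕ<n v)))

  vertex-+M : ∀ i → vertex (i ℕ.+ M) ≡ vertex i
  vertex-+M i = sym (vertex-≡ (i ℕ.+ M) (trans (toℕ-vertex i) (sym ([m+n]%n≡m%n i M))))

  toℕ-vertex-suc : ∀ i → toℕ (vertex (suc i)) ≡ suc (toℕ (vertex i)) % M
  toℕ-vertex-suc i = begin
    toℕ (vertex (suc i))       ≡⟨ toℕ-vertex (suc i) ⟩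
    suc i % M                  ≡⟨ [m+n%d]%d≡[m+n]%d 1 i M ⟨
    suc (i % M) % M            ≡⟨ cong (λ x → suc x % M) (toℕ-vertex i) ⟨
    suc (toℕ (vertex i)) % M   ∎
    where open ≡-Reasoning

  adj-vertex-suc : ∀ i → adj (Cycle M) (vertex i) (vertex (suc i)) ≡ true
  adj-vertex-suc i = Equivalence.to T-≡ (Equivalence.from T-∨ (inj₁ (ℕ.≡⇒≡ᵇ _ _ (toℕ-vertex-suc i))))

  adj⇒consecutive : ∀ {v w} → adj (Cycle M) v w ≡ true →
    w ≡ vertex (suc (toℕ v)) ⊎ v ≡ vertex (suc (toℕ w))
  adj⇒consecutive {v} {w} vw with Equivalence.to T-∨ (Equivalence.from T-≡ vw)
  ... | inj₁ w≡v+1 = inj₁ (vertex-≡ (suc (toℕ v)) (ℕ.≡ᵇ⇒≡ _ _ w≡v+1))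
  ... | inj₂ v≡w+1 = inj₂ (vertex-≡ (suc (toℕ w)) (ℕ.≡ᵇ⇒≡ _ _ v≡w+1))

  vertex-suc-suc≢vertex : ∀ i → vertex (suc (suc i)) ≢ vertex i
  vertex-suc-suc≢vertex i eq = [s+m]%d≢m%d i (s≤s z≤n) (s≤s (s≤s (s≤s z≤n))) (begin
    suc (suc i) % M          ≡⟨ toℕ-vertex (suc (suc i)) ⟨
    toℕ (vertex (suc (suc i))) ≡⟨ cong toℕ eq ⟩
    toℕ (vertex i)           ≡⟨ toℕ-vertex i ⟩
    i % M                    ∎)
    where open ≡-Reasoning

  adj-vertex-suc-≡ : ∀ i w → adj (Cycle M) (vertex (suc i)) w ≡ at (vertex (suc (suc i))) w ∨ at (vertex i) w
  adj-vertex-suc-≡ i w =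
    cong₂ _∨_ (cong (toℕ w ℕ.≡ᵇ_) (sym (toℕ-vertex-suc (suc i))))
              (does-⇔ (mk⇔ to from) (_ ℕ.≟ _) (_ ℕ.≟ _))
    where
      to : toℕ (vertex (suc i)) ≡ suc (toℕ w) % M → toℕ w ≡ toℕ (vertex i)
      to eq = begin
        toℕ w           ≡⟨ m<n⇒m%n≡m (Fin.toℕ<n w) ⟨
        toℕ w % M       ≡⟨ [1+m]%d≡[1+n]%d⇒m%d≡n%d (toℕ w) i M (trans (sym eq) (toℕ-vertex (suc i))) ⟩
        i % M           ≡⟨ toℕ-vertex i ⟨
        toℕ (vertex i)  ∎
        where open ≡-Reasoning
      from : toℕ w ≡ toℕ (vertex i) → toℕ (vertex (suc i)) ≡ suc (toℕ w) % M
      from eq = trans (toℕ-vertex-suc i) (cong (λ x → suc x % M) (sym eq))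

  closedSum-vertex : ∀ (ℓ : Fin M → ℤ) i →
    closedSum (Cycle M) ℓ (vertex (suc i)) ≡ ℓ (vertex (suc i)) + (ℓ (vertex (suc (suc i))) + ℓ (vertex i))
  closedSum-vertex ℓ i = cong (_+_ (ℓ (vertex (suc i)))) (begin
    sumFin M (restrict (adj (Cycle M) (vertex (suc i))) ℓ)
      ≡⟨ sumFin≡sum M (restrict (adj (Cycle M) (vertex (suc i))) ℓ) ⟩
    sum (restrict (adj (Cycle M) (vertex (suc i))) ℓ)
      ≡⟨ sum-cong-≗ (λ w → cong (λ x → if x then ℓ w else + 0) (adj-vertex-suc-≡ i w)) ⟩
    sum (restrict (λ w → at (vertex (suc (suc i))) w ∨ at (vertex i) w) ℓ)
      ≡⟨ sum-restrict-at₂ ℓ (vertex-suc-suc≢vertex i) ⟩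
    ℓ (vertex (suc (suc i))) + ℓ (vertex i)
      ∎)
    where open ≡-Reasoning

  vertex-*M : ∀ j → vertex (j ℕ.* M) ≡ vertex 0
  vertex-*M zero    = refl
  vertex-*M (suc j) = trans (cong vertex (ℕ.+-comm M (j ℕ.* M))) (trans (vertex-+M (j ℕ.* M)) (vertex-*M j))

  vertex-suc-pred : ∀ v → v ≡ vertex (suc (toℕ v ℕ.+ suc (suc r)))
  vertex-suc-pred v = begin
    v                                       ≡⟨ vertex-toℕ v ⟩
    vertex (toℕ v)                          ≡⟨ vertex-+M (toℕ v) ⟨
    vertex (toℕ v ℕ.+ M)                    ≡⟨ cong vertex (ℕ.+-suc (toℕ v) (suc (suc r))) ⟩
    vertex (suc (toℕ v ℕ.+ suc (suc r)))    ∎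
    where open ≡-Reasoning

  module _ {ℓ : Fin M → ℤ} where

    proper⇒ : Proper (Cycle M) ℓ → ∀ i → ℓ (vertex i) ≢ ℓ (vertex (suc i))
    proper⇒ proper i = proper (vertex i) (vertex (suc i)) (adj-vertex-suc i)

    proper⇐ : (∀ i → ℓ (vertex i) ≢ ℓ (vertex (suc i))) → Proper (Cycle M) ℓ
    proper⇐ step v w vw ℓv≡ℓw with adj⇒consecutive vw
    ... | inj₁ w≡ = step (toℕ v) (trans (cong ℓ (sym (vertex-toℕ v))) (trans ℓv≡ℓw (cong ℓ w≡)))
    ... | inj₂ v≡ = step (toℕ w) (trans (cong ℓ (sym (vertex-toℕ w))) (trans (sym ℓv≡ℓw) (cong ℓ v≡)))

    module _ {n : ℕ} {k : ℤ} where

      closed⇒ : ClosedColoring n k (Cycle M) ℓ →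
        ∀ i → ℓ (vertex (suc i)) + (ℓ (vertex (suc (suc i))) + ℓ (vertex i)) ≈ k [mod n ]
      closed⇒ closed i = subst (_≈ k [mod n ]) (closedSum-vertex ℓ i) (≡-mod⇒≈ (closed (vertex (suc i))))

      closed⇐ : (∀ i → ℓ (vertex (suc i)) + (ℓ (vertex (suc (suc i))) + ℓ (vertex i)) ≈ k [mod n ]) →
        ClosedColoring n k (Cycle M) ℓ
      closed⇐ triple v = subst (λ u → closedSum (Cycle M) ℓ u ≡ k [mod n ]) (sym (vertex-suc-pred v))
        (≈⇒≡-mod (subst (_≈ k [mod n ]) (sym (closedSum-vertex ℓ i)) (triple i)))
        where i = toℕ v ℕ.+ suc (suc r)

    2≤order-Cycle : Proper (Cycle M) ℓ → 2 ≤ order (Cycle M) ℓ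
    2≤order-Cycle proper = 2≤order (Cycle M) ℓ (proper⇒ proper 0)

    ℓ≡ℓ₀⊎ℓ≡ℓ₁? : ∀ v → Dec (ℓ v ≡ ℓ (vertex 0) ⊎ ℓ v ≡ ℓ (vertex 1))
    ℓ≡ℓ₀⊎ℓ≡ℓ₁? v = (ℓ v ℤ.≟ ℓ (vertex 0)) ⊎-dec (ℓ v ℤ.≟ ℓ (vertex 1))

    -- Only two labels would force ℓ to alternate around the cycle, impossible when M is odd.
    odd⇒3≤order : Proper (Cycle M) ℓ → ¬ 2 ∣ M → 3 ≤ order (Cycle M) ℓ
    odd⇒3≤order proper M-odd with Fin.all? ℓ≡ℓ₀⊎ℓ≡ℓ₁?
    ... | no ¬twoValued =
      let v , v∉ = Fin.¬∀⟶∃¬ M _ ℓ≡ℓ₀⊎ℓ≡ℓ₁? ¬twoValued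
      in 3≤order (Cycle M) ℓ (proper⇒ proper 0) (λ e → v∉ (inj₁ (sym e))) (λ e → v∉ (inj₂ (sym e)))
    ... | yes twoValued = ⊥-elim (proper⇒ proper 0 (begin
      ℓ (vertex 0)
        ≡⟨ cong ℓ (vertex-+M 0) ⟨
      ℓ (vertex M)
        ≡⟨ cong (ℓ ∘ vertex) (trans (¬2∣m⇒m≡1+[m/2]*2 M M-odd) (ℕ.+-comm 1 _)) ⟩
      ℓ (vertex ((M / 2) ℕ.* 2 ℕ.+ 1))
        ≡⟨ alternating⇒2-periodic (ℓ ∘ vertex) (proper⇒ proper) (twoValued ∘ vertex) (M / 2) 1 ⟩
      ℓ (vertex 1)
        ∎))
      where open ≡-Reasoning

    module _ {n : ℕ} {k : ℤ} (closed : ClosedColoring n k (Cycle M) ℓ) where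

      -- Subtracting the closed sums at the vertices suc i and suc (suc i).
      closed⇒3-periodic : ∀ i → ℓ (vertex (3 ℕ.+ i)) ≈ ℓ (vertex i) [mod n ]
      closed⇒3-periodic i with closed⇒ closed (suc i) | closed⇒ closed i
      ... | ≈-mod n∣s₁-k | ≈-mod n∣s₀-k = ≈-mod-via (Signed.∣m∣n⇒∣m-n n∣s₁-k n∣s₀-k)
        (difference (ℓ (vertex i)) (ℓ (vertex (1 ℕ.+ i))) (ℓ (vertex (2 ℕ.+ i))) (ℓ (vertex (3 ℕ.+ i))) k)
        where
          difference : ∀ a b c d k → ((c + (d + b)) - k) - ((b + (c + a)) - k) ≡ d - a
          difference = solve-∀

      closed⇒3q-periodic : ∀ q i → ℓ (vertex (q ℕ.* 3 ℕ.+ i)) ≈ ℓ (vertex i) [mod n ]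
      closed⇒3q-periodic zero    i = ≈-reflexive refl
      closed⇒3q-periodic (suc q) i = ≈-trans (closed⇒3-periodic (q ℕ.* 3 ℕ.+ i)) (closed⇒3q-periodic q i)

      3q+i≡jM⇒ℓ[i]≈ℓ[0] : ∀ q i j → q ℕ.* 3 ℕ.+ i ≡ j ℕ.* M → ℓ (vertex i) ≈ ℓ (vertex 0) [mod n ]
      3q+i≡jM⇒ℓ[i]≈ℓ[0] q i j 3q+i≡jM = ≈-trans (≈-sym (closed⇒3q-periodic q i))
        (≈-reflexive (cong ℓ (trans (cong vertex 3q+i≡jM) (vertex-*M j))))

      constant-residue⇒gcd∣k : ℓ (vertex 1) ≈ ℓ (vertex 0) [mod n ] → ℓ (vertex 2) ≈ ℓ (vertex 0) [mod n ] →
        (+ gcd 3 n) ∣ℤ k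
      constant-residue⇒gcd∣k ℓ₁≈ℓ₀ ℓ₂≈ℓ₀ = 3*b≈k⇒gcd[3,n]∣k (begin
        + 3 * ℓ (vertex 0)
          ≡⟨ triple (ℓ (vertex 0)) ⟩
        ℓ (vertex 0) + (ℓ (vertex 0) + ℓ (vertex 0))
          ≈⟨ +-cong-≈ (≈-sym ℓ₁≈ℓ₀) (+-cong-≈ (≈-sym ℓ₂≈ℓ₀) (≈-reflexive refl)) ⟩
        ℓ (vertex 1) + (ℓ (vertex 2) + ℓ (vertex 0))
          ≈⟨ closed⇒ closed 0 ⟩
        k ∎)
        where
          open SetoidReasoning (≈-setoid n)
          triple : ∀ a → + 3 * a ≡ a + (a + a)
          triple = solve-∀

      -- When 3 ∤ M, walking around the cycle once or twice reaches vertex 1 and vertex 2 in steps of 3.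
      ¬3∣M⇒gcd∣k : ¬ 3 ∣ M → (+ gcd 3 n) ∣ℤ k
      ¬3∣M⇒gcd∣k 3∤M with M % 3 | m≡m%n+[m/n]*n M 3 | m%n<n M 3
      ... | 0 | M≡3q | _ = contradiction (ℕ.divides (M / 3) M≡3q) 3∤M
      ... | 1 | M≡1+3q | _ = constant-residue⇒gcd∣k
        (3q+i≡jM⇒ℓ[i]≈ℓ[0] (M / 3) 1 1 (trans (once (M / 3)) (cong (1 ℕ.*_) (sym M≡1+3q))))
        (3q+i≡jM⇒ℓ[i]≈ℓ[0] (M / 3 ℕ.+ M / 3) 2 2 (trans (twice (M / 3)) (cong (2 ℕ.*_) (sym M≡1+3q))))
        where
          once : ∀ q → q ℕ.* 3 ℕ.+ 1 ≡ 1 ℕ.* (1 ℕ.+ q ℕ.* 3)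
          once = ℕ-Solver.solve-∀
          twice : ∀ q → (q ℕ.+ q) ℕ.* 3 ℕ.+ 2 ≡ 2 ℕ.* (1 ℕ.+ q ℕ.* 3)
          twice = ℕ-Solver.solve-∀
      ... | 2 | M≡2+3q | _ = constant-residue⇒gcd∣k
        (3q+i≡jM⇒ℓ[i]≈ℓ[0] (1 ℕ.+ M / 3 ℕ.+ M / 3) 1 2 (trans (twice (M / 3)) (cong (2 ℕ.*_) (sym M≡2+3q))))
        (3q+i≡jM⇒ℓ[i]≈ℓ[0] (M / 3) 2 1 (trans (once (M / 3)) (cong (1 ℕ.*_) (sym M≡2+3q))))
        where
          once : ∀ q → q ℕ.* 3 ℕ.+ 2 ≡ 1 ℕ.* (2 ℕ.+ q ℕ.* 3)
          once = ℕ-Solver.solve-∀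
          twice : ∀ q → (1 ℕ.+ q ℕ.+ q) ℕ.* 3 ℕ.+ 1 ≡ 2 ℕ.* (2 ℕ.+ q ℕ.* 3)
          twice = ℕ-Solver.solve-∀
      ... | suc (suc (suc _)) | _ | s≤s (s≤s (s≤s ()))

      ¬gcd∣k⇒3≤order : Proper (Cycle M) ℓ → ¬ (+ gcd 3 n) ∣ℤ k → 3 ≤ order (Cycle M) ℓ
      ¬gcd∣k⇒3≤order proper gcd∤k with ℓ (vertex 2) ℤ.≟ ℓ (vertex 0)
      ... | no ℓ₂≢ℓ₀ = 3≤order (Cycle M) ℓ (proper⇒ proper 0) (ℓ₂≢ℓ₀ ∘ sym) (proper⇒ proper 1)
      ... | yes ℓ₂≡ℓ₀ with ℓ (vertex 3) ℤ.≟ ℓ (vertex 1)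
      ...   | no ℓ₃≢ℓ₁ =
        3≤order (Cycle M) ℓ (proper⇒ proper 0) (λ ℓ₀≡ℓ₃ → proper⇒ proper 2 (trans ℓ₂≡ℓ₀ ℓ₀≡ℓ₃)) (ℓ₃≢ℓ₁ ∘ sym)
      ...   | yes ℓ₃≡ℓ₁ = ⊥-elim (gcd∤k (constant-residue⇒gcd∣k
        (subst (_≈ ℓ (vertex 0) [mod n ]) ℓ₃≡ℓ₁ (closed⇒3-periodic 0)) (≈-reflexive ℓ₂≡ℓ₀)))

  module _ {n : ℕ} {k b : ℤ} {ℓ : Fin M → ℤ} where

    constant-residue⇒closed : (∀ v → ℓ v ≈ b [mod n ]) → + 3 * b ≈ k [mod n ] → ClosedColoring n k (Cycle M) ℓ
    constant-residue⇒closed ℓ≈b 3b≈k = closed⇐ {ℓ = ℓ} λ i → begin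
      ℓ (vertex (suc i)) + (ℓ (vertex (suc (suc i))) + ℓ (vertex i))
        ≈⟨ +-cong-≈ (ℓ≈b _) (+-cong-≈ (ℓ≈b _) (ℓ≈b _)) ⟩
      b + (b + b)
        ≡⟨ triple b ⟨
      + 3 * b
        ≈⟨ 3b≈k ⟩
      k ∎
      where
        open SetoidReasoning (≈-setoid n)
        triple : ∀ a → + 3 * a ≡ a + (a + a)
        triple = solve-∀

  module _ (n : ℕ) .{{_ : ℕ.NonZero n}} (b : ℤ) (c : ℕ → ℕ) where

    colouring : Fin M → ℤ
    colouring v = b + + n * + c (toℕ v)

    colouring-proper : (∀ i → c (i % M) ≢ c (suc i % M)) → Proper (Cycle M) colouring
    colouring-proper step = proper⇐ λ i eq → step i (b+n*-injective b n (begin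
      b + + n * + c (i % M)                ≡⟨ cong (λ x → b + + n * + c x) (toℕ-vertex i) ⟨
      colouring (vertex i)                 ≡⟨ eq ⟩
      colouring (vertex (suc i))           ≡⟨ cong (λ x → b + + n * + c x) (toℕ-vertex (suc i)) ⟩
      b + + n * + c (suc i % M)            ∎))
      where open ≡-Reasoning

    colouring-closed : ∀ {k} → + 3 * b ≈ k [mod n ] → ClosedColoring n k (Cycle M) colouring
    colouring-closed = constant-residue⇒closed (λ v → +-multiple-≈ b (+ c (toℕ v)))

    colouring-order≤ : ∀ {d} → (∀ x → c x < d) → order (Cycle M) colouring ≤ d
    colouring-order≤ c<d = order-∘≤ (Cycle M) (λ x → b + + n * + x) (c ∘ toℕ) (c<d ∘ toℕ)

  parity-alternates : 2 ∣ M → ∀ i → i % M % 2 ≢ suc i % M % 2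
  parity-alternates 2∣M i eq = [s+m]%d≢m%d i (s≤s z≤n) (s≤s (s≤s z≤n)) (begin
    suc i % 2        ≡⟨ m∣n⇒o%n%m≡o%m 2 M (suc i) 2∣M ⟨
    suc i % M % 2    ≡⟨ eq ⟨
    i % M % 2        ≡⟨ m∣n⇒o%n%m≡o%m 2 M i 2∣M ⟩
    i % 2            ∎)
    where open ≡-Reasoning

  oddColour : ℕ → ℕ
  oddColour x with x ℕ.≟ suc (suc r)
  ... | yes _ = 2
  ... | no  _ = x % 2

  oddColour<3 : ∀ x → oddColour x < 3
  oddColour<3 x with x ℕ.≟ suc (suc r)
  ... | yes _ = ℕ.≤-refl
  ... | no  _ = ℕ.<-trans (m%n<n x 2) ℕ.≤-refl

  oddColour-last : oddColour (suc (suc r)) ≡ 2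
  oddColour-last with suc (suc r) ℕ.≟ suc (suc r)
  ... | yes _   = refl
  ... | no  r≢r = contradiction refl r≢r

  oddColour-other : ∀ {x} → x ≢ suc (suc r) → oddColour x ≡ x % 2
  oddColour-other {x} x≢last with x ℕ.≟ suc (suc r)
  ... | yes x≡last = contradiction x≡last x≢last
  ... | no  _      = refl

  oddColour-alternates : ∀ i → oddColour (i % M) ≢ oddColour (suc i % M)
  oddColour-alternates i = subst (λ y → oddColour (i % M) ≢ oddColour y) ([m+n%d]%d≡[m+n]%d 1 i M)
    (step (i % M) (m%n<n i M) (i % M ℕ.≟ suc (suc r)))
    where
      step : ∀ x → x < M → Dec (x ≡ suc (suc r)) → oddColour x ≢ oddColour (suc x % M)
      step x _ (yes refl) eq with () ← trans (sym oddColour-last) (trans eq (cong oddColour (n%n≡0 M)))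
      step x x<M (no x≢last) eq with suc x ℕ.≟ suc (suc r)
      ... | yes x+1≡last = ℕ.<⇒≢ (m%n<n x 2) (begin
        x % 2                ≡⟨ oddColour-other x≢last ⟨
        oddColour x          ≡⟨ eq ⟩
        oddColour (suc x % M) ≡⟨ cong oddColour (trans (m<n⇒m%n≡m x+1<M) x+1≡last) ⟩
        oddColour (suc (suc r)) ≡⟨ oddColour-last ⟩
        2                    ∎)
        where
          open ≡-Reasoning
          x+1<M : suc x < M
          x+1<M = s≤s (ℕ.≤-reflexive x+1≡last)
      ... | no x+1≢last = [s+m]%d≢m%d x (s≤s z≤n) (s≤s (s≤s z≤n)) (begin
        suc x % 2               ≡⟨ oddColour-other x+1≢last ⟨
        oddColour (suc x)       ≡⟨ cong oddColour (m<n⇒m%n≡m x+1<M) ⟨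
        oddColour (suc x % M)   ≡⟨ eq ⟨
        oddColour x             ≡⟨ oddColour-other x≢last ⟩
        x % 2                   ∎)
        where
          open ≡-Reasoning
          x+1<M : suc x < M
          x+1<M = s≤s (ℕ.≤∧≢⇒< (ℕ.≤-pred x<M) x≢last)

  module _ (n : ℕ) (k : ℤ) (3∣M : 3 ∣ M) where

    threeLabeling : Fin M → ℤ
    threeLabeling v = threeLabel n k (toℕ v % 3)

    threeLabeling-vertex : ∀ i → threeLabeling (vertex i) ≡ threeLabel n k (i % 3)
    threeLabeling-vertex i = cong (threeLabel n k) (trans (cong (_% 3) (toℕ-vertex i)) (m∣n⇒o%n%m≡o%m 3 M i 3∣M))

    threeLabeling-closed : ClosedColoring n k (Cycle M) threeLabeling
    threeLabeling-closed = closed⇐ {ℓ = threeLabeling} λ i → ≈-reflexive (begin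
      threeLabeling (vertex (suc i)) + (threeLabeling (vertex (suc (suc i))) + threeLabeling (vertex i))
        ≡⟨ cong₂ _+_ (threeLabeling-vertex (suc i))
                     (cong₂ _+_ (threeLabeling-vertex (suc (suc i))) (threeLabeling-vertex i)) ⟩
      threeLabel n k (suc i % 3) + (threeLabel n k (suc (suc i) % 3) + threeLabel n k (i % 3))
        ≡⟨ cong₂ (λ x y → threeLabel n k x + (threeLabel n k y + threeLabel n k (i % 3)))
             ([m+n%d]%d≡[m+n]%d 1 i 3) ([m+n%d]%d≡[m+n]%d 2 i 3) ⟨
      threeLabel n k (suc (i % 3) % 3) + (threeLabel n k (suc (suc (i % 3)) % 3) + threeLabel n k (i % 3))
        ≡⟨ threeLabel-sum n k (i % 3) (m%n<n i 3) ⟩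
      k ∎)
      where open ≡-Reasoning

    threeLabeling-order≤ : order (Cycle M) threeLabeling ≤ 3
    threeLabeling-order≤ = order-∘≤ (Cycle M) (threeLabel n k) (λ v → toℕ v % 3) (λ v → m%n<n (toℕ v) 3)

    threeLabeling-proper : .{{ℕ.NonZero n}} → ¬ (+ gcd 3 n) ∣ℤ k → Proper (Cycle M) threeLabeling
    threeLabeling-proper gcd∤k = proper⇐ {ℓ = threeLabeling} λ i eq →
      threeLabel-distinct n k gcd∤k (i % 3) (m%n<n i 3) (begin
        threeLabel n k (i % 3)              ≡⟨ threeLabeling-vertex i ⟨
        threeLabeling (vertex i)            ≡⟨ eq ⟩
        threeLabeling (vertex (suc i))      ≡⟨ threeLabeling-vertex (suc i) ⟩
        threeLabel n k (suc i % 3)          ≡⟨ cong (threeLabel n k) ([m+n%d]%d≡[m+n]%d 1 i 3) ⟨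
        threeLabel n k (suc (i % 3) % 3)    ∎)
      where open ≡-Reasoning

χ≡-intro : ∀ {n k G c} (ℓ : Labeling G) → ProperClosed n k G ℓ → order G ℓ ≤ c →
  (∀ ℓ′ → ProperClosed n k G ℓ′ → c ≤ order G ℓ′) → χ≡ n k G c
χ≡-intro ℓ properClosed order≤c c≤order =
  (ℓ , properClosed , ℕ.≤-antisym order≤c (c≤order ℓ properClosed)) , c≤order

theorem4p5 : (k : ℤ) (n m : ℕ) → 1 ≤ n → 3 ≤ m →
    ((+ gcd 3 n) ∣ℤ k → 2 ∣ m → χ≡ n k (Cycle m) 2)
    × ((+ gcd 3 n) ∣ℤ k → ¬ (2 ∣ m) → χ≡ n k (Cycle m) 3)
    × (¬ ((+ gcd 3 n) ∣ℤ k) → 3 ∣ m → χ≡ n k (Cycle m) 3)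
    × (¬ ((+ gcd 3 n) ∣ℤ k) → ¬ (3 ∣ m) → ¬ χExists n k (Cycle m))
theorem4p5 k n@(suc _) (suc (suc (suc r))) (s≤s z≤n) (s≤s (s≤s (s≤s z≤n))) = even , odd , divisible , none
  where
    open CycleOf r

    even : (+ gcd 3 n) ∣ℤ k → 2 ∣ M → χ≡ n k (Cycle M) 2
    even g∣k 2∣M with b , 3b≈k ← gcd[3,n]∣k⇒∃3*b≈k n k g∣k =
      χ≡-intro (colouring n b (_% 2))
        (colouring-proper n b (_% 2) (parity-alternates 2∣M) , colouring-closed n b (_% 2) 3b≈k)
        (colouring-order≤ n b (_% 2) (λ x → m%n<n x 2))
        (λ _ (proper , _) → 2≤order-Cycle proper)

    odd : (+ gcd 3 n) ∣ℤ k → ¬ 2 ∣ M → χ≡ n k (Cycle M) 3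
    odd g∣k 2∤M with b , 3b≈k ← gcd[3,n]∣k⇒∃3*b≈k n k g∣k =
      χ≡-intro (colouring n b oddColour)
        (colouring-proper n b oddColour oddColour-alternates , colouring-closed n b oddColour 3b≈k)
        (colouring-order≤ n b oddColour oddColour<3)
        (λ _ (proper , _) → odd⇒3≤order proper 2∤M)

    divisible : ¬ (+ gcd 3 n) ∣ℤ k → 3 ∣ M → χ≡ n k (Cycle M) 3
    divisible gcd∤k 3∣M =
      χ≡-intro (threeLabeling n k 3∣M)
        (threeLabeling-proper n k 3∣M gcd∤k , threeLabeling-closed n k 3∣M)
        (threeLabeling-order≤ n k 3∣M)
        (λ ℓ (proper , closed) → ¬gcd∣k⇒3≤order {ℓ} {n} {k} closed proper gcd∤k)

    none : ¬ (+ gcd 3 n) ∣ℤ k → ¬ 3 ∣ M → ¬ χExists n k (Cycle M)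
    none gcd∤k 3∤M (ℓ , _ , closed) = gcd∤k (¬3∣M⇒gcd∣k {ℓ} {n} {k} closed 3∤M)
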